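{- Let $n \geqslant 3$ and let $j_0, j_1 \in \{1, 2, \ldots, \lfloor n/2 \rfloor\}$. Define the sequence $(a_m)_{m=0}^{n-1}$ in $\mathbb{Z}_n$ by $a_0 = 0$ and $a_m = \sum_{i=0}^{m-1} j_{i \bmod 2} \pmod{n}$ for $m \geqslant 1$, and let $S = \{a_0, a_1, \ldots, a_{n-1}\} \subseteq \mathbb{Z}_n$. Let $h = n - (j_0 + j_1)$ and let $H = \langle h \rangle$ be the subgroup of the cyclic group $\mathbb{Z}_n$ generated by $h$. Then $$|S| \leqslant \begin{cases} |H| & \text{if } j_0 \in H,\\ 2|H| & \text{if } j_0 \notin H.\end{cases}$$
   Context: $\mathbb{Z}_n$ denotes the cyclic group of order $n$ (integers modulo $n$ under addition), and for $m \in \mathbb{Z}_n$, $\langle m \rangle = \{tm : t \in \mathbb{Z}\} \pmod n$. The set $S$ is the set generated by the periodic jump sequence $(j_0, j_1)$: starting at $0$, one alternately adds $j_0$ and $j_1$ modulo $n$. -}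

module Defs where

open import Data.Nat using (ℕ; zero; suc; _+_; _*_; NonZero)
open import Data.Nat.DivMod using (_%_; _mod_)
open import Data.Fin using (Fin)
open import Data.Fin.Subset using (Subset; ⋃; ⁅_⁆)
open import Data.List using (List; map; upTo)

jump : ℕ → ℕ → ℕ → ℕ
jump j₀ j₁ i with i % 2
... | zero  = j₀
... | suc _ = j₁

partialSum : ℕ → ℕ → ℕ → ℕ
partialSum j₀ j₁ zero    = 0
partialSum j₀ j₁ (suc m) = partialSum j₀ j₁ m + jump j₀ j₁ m

seqA : (n : ℕ) .{{_ : NonZero n}} → ℕ → ℕ → ℕ → Fin n
seqA n j₀ j₁ m = partialSum j₀ j₁ m mod n

setS : (n : ℕ) .{{_ : NonZero n}} → ℕ → ℕ → Subset n
setS n j₀ j₁ = ⋃ (map (λ m → ⁅ seqA n j₀ j₁ m ⁆) (upTo n))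

-- ⟨ g ⟩ = { t·g mod n : t ∈ ℤ } ⊆ ℤ_n for g ∈ ℕ; since t·g mod n only depends
-- on t mod n, it suffices to let t range over 0, …, n-1.
cyclicSubgroup : (n : ℕ) .{{_ : NonZero n}} → ℕ → Subset n
cyclicSubgroup n g = ⋃ (map (λ t → ⁅ (t * g) mod n ⁆) (upTo n))

-- Over two steps the walk advances by s = j₀ + j₁, and s ≡ -h ≡ (n - 1)·h (mod n) because
-- h = n - s.  Hence a_{2q} ∈ H and a_{2q+1} = a_{2q} + j₀ ∈ j₀ + H, so S ⊆ H ∪ (j₀ + H).
-- If j₀ ∈ H the coset j₀ + H is H itself; otherwise S lies in two cosets of H.
module Submission where

open import Defs
open import Data.Nat using (ℕ; _+_; _*_; _∸_; _≤_; _/_; NonZero)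
open import Data.Nat.DivMod using (_mod_)
open import Data.Fin.Subset using (_∈_; _∉_; ∣_∣)
open import Data.Product using (_×_)

open import Data.Nat using (zero; suc; _%_; z≤n; s≤s)
open import Data.Nat.Properties
open import Data.Nat.DivMod
  using (m%n<n; m%n%n≡m%n; %-distribˡ-+; %-distribˡ-*; [m+kn]%n≡m%n; m*n%n≡0; m≡m%n+[m/n]*n; m/n*n≤m)
open import Data.Nat.Tactic.RingSolver using (solve-∀)
open import Data.Fin using (Fin; toℕ) renaming (zero to fzero; suc to fsuc)
open import Data.Fin.Properties using (fromℕ<-cong; toℕ-fromℕ<)
open import Data.Fin.Subset using (Subset; inside; outside; ⋃; ⁅_⁆; _∪_; _⊆_)
open import Data.Fin.Subset.Properties
  using (x∈p∪q⁻; x∈p∪q⁺; x∈⁅x⁆; x∈⁅y⁆⇒x≡y; ∉⊥; _∈?_; p⊆q⇒∣p∣≤∣q∣; ∣q∣≤∣p∪q∣; ∪-identityˡ)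
open import Data.Vec using ([]; _∷_; here; there)
open import Data.List using (List; map; upTo) renaming ([] to []ᴸ; _∷_ to _∷ᴸ_)
import Data.List.Relation.Unary.Any as Any
import Data.List.Membership.Propositional as List
open import Data.List.Membership.Propositional.Properties using (∈-upTo⁺)
open import Data.Product using (∃-syntax; _,_)
open import Data.Sum using (_⊎_; inj₁; inj₂; [_,_])
open import Data.Empty using (⊥-elim)
open import Function using (_∘_)
open import Relation.Nullary using (yes; no)
open import Relation.Binary.PropositionalEquality using (_≡_; refl; sym; trans; cong; cong₂; subst; module ≡-Reasoning)

∣p∪q∣≤∣p∣+∣q∣ : ∀ {n} (p q : Subset n) → ∣ p ∪ q ∣ ≤ ∣ p ∣ + ∣ q ∣
∣p∪q∣≤∣p∣+∣q∣ []            []            = z≤n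
∣p∪q∣≤∣p∣+∣q∣ (inside  ∷ p) (inside  ∷ q) = s≤s (≤-trans (∣p∪q∣≤∣p∣+∣q∣ p q) (+-monoʳ-≤ ∣ p ∣ (n≤1+n _)))
∣p∪q∣≤∣p∣+∣q∣ (inside  ∷ p) (outside ∷ q) = s≤s (∣p∪q∣≤∣p∣+∣q∣ p q)
∣p∪q∣≤∣p∣+∣q∣ (outside ∷ p) (inside  ∷ q) rewrite +-suc ∣ p ∣ ∣ q ∣ = s≤s (∣p∪q∣≤∣p∣+∣q∣ p q)
∣p∪q∣≤∣p∣+∣q∣ (outside ∷ p) (outside ∷ q) = ∣p∪q∣≤∣p∣+∣q∣ p q

x∈p⇒∣⁅x⁆∪p∣≡∣p∣ : ∀ {n} {x : Fin n} {p : Subset n} → x ∈ p → ∣ ⁅ x ⁆ ∪ p ∣ ≡ ∣ p ∣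
x∈p⇒∣⁅x⁆∪p∣≡∣p∣ {p = inside ∷ p} here = cong (λ q → suc ∣ q ∣) (∪-identityˡ p)
x∈p⇒∣⁅x⁆∪p∣≡∣p∣ {p = inside  ∷ p} (there x∈p) = cong suc (x∈p⇒∣⁅x⁆∪p∣≡∣p∣ x∈p)
x∈p⇒∣⁅x⁆∪p∣≡∣p∣ {p = outside ∷ p} (there x∈p) = x∈p⇒∣⁅x⁆∪p∣≡∣p∣ x∈p

x∉p⇒∣⁅x⁆∪p∣≡1+∣p∣ : ∀ {n} {x : Fin n} {p : Subset n} → x ∉ p → ∣ ⁅ x ⁆ ∪ p ∣ ≡ suc ∣ p ∣
x∉p⇒∣⁅x⁆∪p∣≡1+∣p∣ {x = fzero}  {inside  ∷ p} x∉p = ⊥-elim (x∉p here)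
x∉p⇒∣⁅x⁆∪p∣≡1+∣p∣ {x = fzero}  {outside ∷ p} x∉p = cong (λ q → suc ∣ q ∣) (∪-identityˡ p)
x∉p⇒∣⁅x⁆∪p∣≡1+∣p∣ {x = fsuc x} {inside  ∷ p} x∉p = cong suc (x∉p⇒∣⁅x⁆∪p∣≡1+∣p∣ (x∉p ∘ there))
x∉p⇒∣⁅x⁆∪p∣≡1+∣p∣ {x = fsuc x} {outside ∷ p} x∉p = x∉p⇒∣⁅x⁆∪p∣≡1+∣p∣ (x∉p ∘ there)

∪-least : ∀ {n} {p q r : Subset n} → p ⊆ r → q ⊆ r → p ∪ q ⊆ r
∪-least {p = p} {q} p⊆r q⊆r x∈p∪q = [ p⊆r , q⊆r ] (x∈p∪q⁻ p q x∈p∪q)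

module _ {A : Set} {n : ℕ} where

  image : (A → Fin n) → List A → Subset n
  image f xs = ⋃ (map (λ x → ⁅ f x ⁆) xs)

  ∈-image⁺ : ∀ (f : A → Fin n) {x xs} → x List.∈ xs → f x ∈ image f xs
  ∈-image⁺ f (Any.here refl) = x∈p∪q⁺ (inj₁ (x∈⁅x⁆ (f _)))
  ∈-image⁺ f (Any.there x∈xs) = x∈p∪q⁺ (inj₂ (∈-image⁺ f x∈xs))

  ∈-image⁻ : ∀ (f : A → Fin n) xs {y} → y ∈ image f xs → ∃[ x ] x List.∈ xs × y ≡ f x
  ∈-image⁻ f []ᴸ y∈ = ⊥-elim (∉⊥ y∈)
  ∈-image⁻ f (x ∷ᴸ xs) y∈ with x∈p∪q⁻ ⁅ f x ⁆ (image f xs) y∈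
  ... | inj₁ y∈⁅fx⁆ = x , Any.here refl , x∈⁅y⁆⇒x≡y (f x) y∈⁅fx⁆
  ... | inj₂ y∈rest with ∈-image⁻ f xs y∈rest
  ...   | x′ , x′∈xs , y≡fx′ = x′ , Any.there x′∈xs , y≡fx′

  factors⇒∣image∣≤∣image∣ : ∀ (f g : A → Fin n) → (∀ x y → g x ≡ g y → f x ≡ f y) →
                            ∀ xs → ∣ image f xs ∣ ≤ ∣ image g xs ∣
  factors⇒∣image∣≤∣image∣ f g factor []ᴸ = ≤-refl
  factors⇒∣image∣≤∣image∣ f g factor (x ∷ᴸ xs) with f x ∈? image f xs
  ... | yes fx∈ = begin
    ∣ ⁅ f x ⁆ ∪ image f xs ∣  ≡⟨ x∈p⇒∣⁅x⁆∪p∣≡∣p∣ fx∈ ⟩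
    ∣ image f xs ∣            ≤⟨ factors⇒∣image∣≤∣image∣ f g factor xs ⟩
    ∣ image g xs ∣            ≤⟨ ∣q∣≤∣p∪q∣ ⁅ g x ⁆ (image g xs) ⟩
    ∣ ⁅ g x ⁆ ∪ image g xs ∣  ∎
    where open ≤-Reasoning
  ... | no fx∉ = begin
    ∣ ⁅ f x ⁆ ∪ image f xs ∣  ≡⟨ x∉p⇒∣⁅x⁆∪p∣≡1+∣p∣ fx∉ ⟩
    suc ∣ image f xs ∣        ≤⟨ s≤s (factors⇒∣image∣≤∣image∣ f g factor xs) ⟩
    suc ∣ image g xs ∣        ≡⟨ sym (x∉p⇒∣⁅x⁆∪p∣≡1+∣p∣ gx∉) ⟩
    ∣ ⁅ g x ⁆ ∪ image g xs ∣  ∎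
    where
    open ≤-Reasoning
    gx∉ : g x ∉ image g xs
    gx∉ gx∈ with ∈-image⁻ g xs gx∈
    ... | y , y∈xs , gx≡gy = fx∉ (subst (_∈ image f xs) (sym (factor x y gx≡gy)) (∈-image⁺ f y∈xs))

module _ {n : ℕ} .{{_ : NonZero n}} where

  mod-cong : ∀ a b → a % n ≡ b % n → a mod n ≡ b mod n
  mod-cong a b eq = fromℕ<-cong _ _ eq (m%n<n a n) (m%n<n b n)

  mod-injective : ∀ a b → a mod n ≡ b mod n → a % n ≡ b % n
  mod-injective a b eq = trans (sym (toℕ-fromℕ< (m%n<n a n))) (trans (cong toℕ eq) (toℕ-fromℕ< (m%n<n b n)))

  %-cong-+ : ∀ a a′ b b′ → a % n ≡ a′ % n → b % n ≡ b′ % n → (a + b) % n ≡ (a′ + b′) % n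
  %-cong-+ a a′ b b′ a≡a′ b≡b′ = begin
    (a + b) % n              ≡⟨ %-distribˡ-+ a b n ⟩
    (a % n + b % n) % n      ≡⟨ cong₂ (λ x y → (x + y) % n) a≡a′ b≡b′ ⟩
    (a′ % n + b′ % n) % n    ≡⟨ %-distribˡ-+ a′ b′ n ⟨
    (a′ + b′) % n            ∎
    where open ≡-Reasoning

  %-cong-* : ∀ a a′ b b′ → a % n ≡ a′ % n → b % n ≡ b′ % n → (a * b) % n ≡ (a′ * b′) % n
  %-cong-* a a′ b b′ a≡a′ b≡b′ = begin
    (a * b) % n              ≡⟨ %-distribˡ-* a b n ⟩
    (a % n * (b % n)) % n    ≡⟨ cong₂ (λ x y → (x * y) % n) a≡a′ b≡b′ ⟩
    (a′ % n * (b′ % n)) % n  ≡⟨ %-distribˡ-* a′ b′ n ⟨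
    (a′ * b′) % n            ∎
    where open ≡-Reasoning

-- a + ⟨g⟩ in ℤ_n; cyclicSubgroup n g is definitionally coset n 0 g.
coset : (n : ℕ) .{{_ : NonZero n}} → ℕ → ℕ → Subset n
coset n a g = image (λ t → (a + t * g) mod n) (upTo n)

module _ {n : ℕ} .{{_ : NonZero n}} where

  ∈-coset⁺ : ∀ {a g} x c → x % n ≡ (a + c * g) % n → x mod n ∈ coset n a g
  ∈-coset⁺ {a} {g} x c x≡a+cg = subst (_∈ coset n a g) (mod-cong _ x reduce) (∈-image⁺ _ (∈-upTo⁺ (m%n<n c n)))
    where
    reduce : (a + c % n * g) % n ≡ x % n
    reduce = trans (%-cong-+ a a _ _ refl (%-cong-* (c % n) c g g (m%n%n≡m%n c n) refl)) (sym x≡a+cg)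

  ∈-coset⁻ : ∀ {a g y} → y ∈ coset n a g → ∃[ c ] y ≡ (a + c * g) mod n
  ∈-coset⁻ y∈ with ∈-image⁻ _ (upTo n) y∈
  ... | c , _ , y≡a+cg = c , y≡a+cg

  coset-⊆ : ∀ {a b g} → a mod n ∈ coset n b g → coset n a g ⊆ coset n b g
  coset-⊆ {a} {b} {g} a∈ y∈ with ∈-coset⁻ a∈ | ∈-coset⁻ y∈
  ... | t , a≡b+tg | c , refl = ∈-coset⁺ (a + c * g) (t + c) (begin
    (a + c * g) % n            ≡⟨ %-cong-+ a _ _ _ (mod-injective a _ a≡b+tg) refl ⟩
    (b + t * g + c * g) % n    ≡⟨ cong (_% n) (+-assoc b (t * g) (c * g)) ⟩
    (b + (t * g + c * g)) % n  ≡⟨ cong (λ x → (b + x) % n) (*-distribʳ-+ g t c) ⟨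
    (b + (t + c) * g) % n      ∎)
    where open ≡-Reasoning

  ∣coset∣≤∣cyclicSubgroup∣ : ∀ a g → ∣ coset n a g ∣ ≤ ∣ cyclicSubgroup n g ∣
  ∣coset∣≤∣cyclicSubgroup∣ a g = factors⇒∣image∣≤∣image∣ _ _ translate (upTo n)
    where
    translate : ∀ x y → (x * g) mod n ≡ (y * g) mod n → (a + x * g) mod n ≡ (a + y * g) mod n
    translate x y xg≡yg = mod-cong _ _ (%-cong-+ a a _ _ refl (mod-injective _ _ xg≡yg))

module _ (j₀ j₁ : ℕ) where

  jump-even : ∀ q → jump j₀ j₁ (q * 2) ≡ j₀
  jump-even q with q * 2 % 2 | m*n%n≡0 q 2
  ... | _ | refl = refl

  jump-odd : ∀ q → jump j₀ j₁ (1 + q * 2) ≡ j₁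
  jump-odd q with (1 + q * 2) % 2 | [m+kn]%n≡m%n 1 q 2
  ... | _ | refl = refl

  partialSum-even : ∀ q → partialSum j₀ j₁ (q * 2) ≡ q * (j₀ + j₁)
  partialSum-odd  : ∀ q → partialSum j₀ j₁ (1 + q * 2) ≡ q * (j₀ + j₁) + j₀

  partialSum-even zero    = refl
  partialSum-even (suc q) = begin
    partialSum j₀ j₁ (1 + q * 2) + jump j₀ j₁ (1 + q * 2)  ≡⟨ cong₂ _+_ (partialSum-odd q) (jump-odd q) ⟩
    q * (j₀ + j₁) + j₀ + j₁                                ≡⟨ +-assoc (q * (j₀ + j₁)) j₀ j₁ ⟩
    q * (j₀ + j₁) + (j₀ + j₁)                              ≡⟨ +-comm (q * (j₀ + j₁)) (j₀ + j₁) ⟩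
    suc q * (j₀ + j₁)                                      ∎
    where open ≡-Reasoning

  partialSum-odd q = cong₂ _+_ (partialSum-even q) (jump-even q)

  partialSum-form : ∀ i → ∃[ q ] (partialSum j₀ j₁ i ≡ q * (j₀ + j₁) ⊎ partialSum j₀ j₁ i ≡ q * (j₀ + j₁) + j₀)
  partialSum-form i with i % 2 | m≡m%n+[m/n]*n i 2 | m%n<n i 2
  ... | 0           | i≡2q   | _ = i / 2 , inj₁ (trans (cong (partialSum j₀ j₁) i≡2q) (partialSum-even (i / 2)))
  ... | 1           | i≡2q+1 | _ = i / 2 , inj₂ (trans (cong (partialSum j₀ j₁) i≡2q+1) (partialSum-odd (i / 2)))
  ... | suc (suc _) | _      | s≤s (s≤s ())

-- s ≡ -h and m ≡ -1 modulo 1 + m.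
s+h≡1+m⇒s≡m*h : ∀ {m s h} → s + h ≡ suc m → s % suc m ≡ (m * h) % suc m
s+h≡1+m⇒s≡m*h {m} {s} {h} s+h≡1+m = begin
  s % suc m                    ≡⟨ [m+kn]%n≡m%n s h (suc m) ⟨
  (s + h * suc m) % suc m      ≡⟨ cong (_% suc m) (trans (shuffle s h m) (cong (λ x → m * h + 1 * x) s+h≡1+m)) ⟩
  (m * h + 1 * suc m) % suc m  ≡⟨ [m+kn]%n≡m%n (m * h) 1 (suc m) ⟩
  (m * h) % suc m              ∎
  where
  open ≡-Reasoning
  shuffle : ∀ s h m → s + h * suc m ≡ m * h + 1 * (s + h)
  shuffle = solve-∀

module _ (m j₀ j₁ : ℕ) (s≤n : j₀ + j₁ ≤ suc m) where

  private
    n = suc m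
    s = j₀ + j₁
    h = n ∸ s

  q*s≡q*m*h : ∀ q → (q * s) % n ≡ (q * m * h) % n
  q*s≡q*m*h q = trans (%-cong-* q q s (m * h) refl (s+h≡1+m⇒s≡m*h (m+[n∸m]≡n s≤n))) (cong (_% n) (sym (*-assoc q m h)))

  setS⊆cyclicSubgroup∪coset : setS n j₀ j₁ ⊆ cyclicSubgroup n h ∪ coset n j₀ h
  setS⊆cyclicSubgroup∪coset z∈S with ∈-image⁻ (seqA n j₀ j₁) (upTo n) z∈S
  ... | i , _ , refl with partialSum-form j₀ j₁ i
  ... | q , inj₁ a≡qs = x∈p∪q⁺ (inj₁ (∈-coset⁺ {a = 0} {g = h} (partialSum j₀ j₁ i) (q * m) (begin
    partialSum j₀ j₁ i % n  ≡⟨ cong (_% n) a≡qs ⟩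
    (q * s) % n             ≡⟨ q*s≡q*m*h q ⟩
    (q * m * h) % n         ∎)))
    where open ≡-Reasoning
  ... | q , inj₂ a≡qs+j₀ = x∈p∪q⁺ (inj₂ (∈-coset⁺ {a = j₀} {g = h} (partialSum j₀ j₁ i) (q * m) (begin
    partialSum j₀ j₁ i % n  ≡⟨ cong (_% n) (trans a≡qs+j₀ (+-comm (q * s) j₀)) ⟩
    (j₀ + q * s) % n        ≡⟨ %-cong-+ j₀ j₀ _ _ refl (q*s≡q*m*h q) ⟩
    (j₀ + q * m * h) % n    ∎)))
    where open ≡-Reasoning

m≤n/2⇒o≤n/2⇒m+o≤n : ∀ {m n o} → m ≤ n / 2 → o ≤ n / 2 → m + o ≤ n
m≤n/2⇒o≤n/2⇒m+o≤n {m} {n} {o} m≤n/2 o≤n/2 = begin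
  m + o            ≤⟨ +-mono-≤ m≤n/2 o≤n/2 ⟩
  n / 2 + n / 2    ≡⟨ cong (n / 2 +_) (+-identityʳ (n / 2)) ⟨
  2 * (n / 2)      ≡⟨ *-comm 2 (n / 2) ⟩
  n / 2 * 2        ≤⟨ m/n*n≤m n 2 ⟩
  n                ∎
  where open ≤-Reasoning

lemma2p4 : (n : ℕ) .{{_ : NonZero n}} → 3 ≤ n → (j₀ j₁ : ℕ) → 1 ≤ j₀ → j₀ ≤ n / 2 → 1 ≤ j₁ → j₁ ≤ n / 2 →
    ((j₀ mod n) ∈ cyclicSubgroup n (n ∸ (j₀ + j₁)) → ∣ setS n j₀ j₁ ∣ ≤ ∣ cyclicSubgroup n (n ∸ (j₀ + j₁)) ∣)
    × ((j₀ mod n) ∉ cyclicSubgroup n (n ∸ (j₀ + j₁)) → ∣ setS n j₀ j₁ ∣ ≤ 2 * ∣ cyclicSubgroup n (n ∸ (j₀ + j₁)) ∣)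
lemma2p4 (suc m) _ j₀ j₁ _ j₀≤n/2 _ j₁≤n/2 = ∣S∣≤∣H∣ , λ _ → ∣S∣≤2∣H∣
  where
  n = suc m
  h = n ∸ (j₀ + j₁)
  S = setS n j₀ j₁
  H = cyclicSubgroup n h
  T = coset n j₀ h

  S⊆H∪T : S ⊆ H ∪ T
  S⊆H∪T = setS⊆cyclicSubgroup∪coset m j₀ j₁ (m≤n/2⇒o≤n/2⇒m+o≤n j₀≤n/2 j₁≤n/2)

  ∣S∣≤∣H∣ : j₀ mod n ∈ H → ∣ S ∣ ≤ ∣ H ∣
  ∣S∣≤∣H∣ j₀∈H = p⊆q⇒∣p∣≤∣q∣ (λ z∈S → ∪-least (λ z∈H → z∈H) (coset-⊆ {a = j₀} {b = 0} {g = h} j₀∈H) (S⊆H∪T z∈S))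

  ∣S∣≤2∣H∣ : ∣ S ∣ ≤ 2 * ∣ H ∣
  ∣S∣≤2∣H∣ = begin
    ∣ S ∣          ≤⟨ p⊆q⇒∣p∣≤∣q∣ S⊆H∪T ⟩
    ∣ H ∪ T ∣      ≤⟨ ∣p∪q∣≤∣p∣+∣q∣ H T ⟩
    ∣ H ∣ + ∣ T ∣  ≤⟨ +-monoʳ-≤ ∣ H ∣ (∣coset∣≤∣cyclicSubgroup∣ j₀ h) ⟩
    ∣ H ∣ + ∣ H ∣  ≡⟨ cong (∣ H ∣ +_) (+-identityʳ ∣ H ∣) ⟨
    2 * ∣ H ∣      ∎
    where open ≤-Reasoning
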